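{- Let $\lambda,\mu\in P(k,\ell)$ and suppose $\mu$ is obtained from $\lambda$ by reducing one part $\lambda_i$ to $\lambda_i-1$. Then the coefficient $D_{\lambda,\mu}$ of $e_\mu$ in $D(e_\lambda)$ in the complex $(\mathcal{C}(\mathbb{F}_2)^G,D)$ equals (the image in $\mathbb{F}_2$ of) $(\ell-\lambda_i+1)(\mathrm{mult}_\lambda(\lambda_i-1)+1)$, where $\mathrm{mult}_\lambda(s)$ is the number of parts of $\lambda$ equal to $s$.
   Context: $P(k,\ell)$ is the set of partitions $\lambda=(\lambda_1,\dots,\lambda_k)$ with $\ell\ge\lambda_1\ge\cdots\ge\lambda_k\ge0$ (exactly $k$ parts, zeros allowed and counted in multiplicities). Let $B$ be the set of $k\ell$ boxes of a $k\times\ell$ rectangle and $G\cong\mathfrak{S}_\ell\wr\mathfrak{S}_k$ the subgroup of permutations of $B$ stabilizing the partition of $B$ into its $k$ rows (permuting rows and permuting boxes within each row). Each $G$-orbit on subsets of $B$ consists of the subsets whose multiset of row-intersection sizes is $\{\lambda_1,\dots,\lambda_k\}$ for a unique $\lambda\in P(k,\ell)$ (it contains the Ferrers diagram of $\lambda$). Let $\mathcal{C}(\mathbb{F}_2)$ be the $\mathbb{F}_2$-space with basis $\{e_S: S\subseteq B\}$ graded by $|S|$, with $G$ permuting the basis, and $D(e_S)=\sum_{x\in S}e_{S\setminus\{x\}}$. $\mathcal{C}(\mathbb{F}_2)^G$ is the space of $G$-invariants, with basis $e_\lambda=\sum_{S\in\Omega_\lambda}e_S$, $\Omega_\lambda$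 the orbit corresponding to $\lambda$; $D$ restricts to a boundary map on it. -}

module Defs where

open import Data.Bool using (Bool; true; false; not; _∧_; _xor_; if_then_else_)
open import Data.Nat using (ℕ; zero; suc; _≤_; _≡ᵇ_)
open import Data.Fin using (Fin)
import Data.Fin as F
open import Data.Fin.Subset using (Subset; ∣_∣)
open import Data.List using (List; []; _∷_; foldr; map; concatMap; allFin; upTo)
open import Data.Vec using (Vec; []; _∷_; lookup; _[_]≔_; countᵇ)
import Data.Vec as V
open import Data.Vec.Properties using (≡-dec)
import Data.Bool.Properties as BP
open import Data.Product using (_×_; _,_)
open import Relation.Nullary.Decidable using (⌊_⌋)

-- F₂ is modelled by Bool with addition _xor_ and multiplication _∧_.
F₂ : Set
F₂ = Bool

Σ₂ : {A : Set} → List A → (A → F₂) → F₂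
Σ₂ xs f = foldr (λ a acc → f a xor acc) false xs

toF₂ : ℕ → F₂
toF₂ zero    = false
toF₂ (suc n) = not (toF₂ n)

-- A subset S of the box set B = Fin k × Fin ℓ, stored row by row:
-- box (r , c) ∈ S iff lookup (lookup S r) c ≡ true.
Sub : ℕ → ℕ → Set
Sub k ℓ = Vec (Subset ℓ) k

allSubsets : (n : ℕ) → List (Subset n)
allSubsets zero    = [] ∷ []
allSubsets (suc n) = concatMap (λ s → (false ∷ s) ∷ (true ∷ s) ∷ []) (allSubsets n)

allSubs : (k ℓ : ℕ) → List (Sub k ℓ)
allSubs zero    ℓ = [] ∷ []
allSubs (suc k) ℓ = concatMap (λ S → map (λ r → r ∷ S) (allSubsets ℓ)) (allSubs k ℓ)

Box : ℕ → ℕ → Set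
Box k ℓ = Fin k × Fin ℓ

allBoxes : (k ℓ : ℕ) → List (Box k ℓ)
allBoxes k ℓ = concatMap (λ r → map (λ c → (r , c)) (allFin ℓ)) (allFin k)

_∈ᵇ_ : ∀ {k ℓ} → Box k ℓ → Sub k ℓ → Bool
(r , c) ∈ᵇ S = lookup (lookup S r) c

_∖_ : ∀ {k ℓ} → Sub k ℓ → Box k ℓ → Sub k ℓ
S ∖ (r , c) = S [ r ]≔ (lookup S r [ c ]≔ false)

_==_ : ∀ {k ℓ} → Sub k ℓ → Sub k ℓ → Bool
S == T = ⌊ ≡-dec (≡-dec BP._≟_) S T ⌋

-- The chain space C(F₂): an element is its coefficient function S ↦ coefficient of e_S.
Chain : ℕ → ℕ → Set
Chain k ℓ = Sub k ℓ → F₂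

e : ∀ {k ℓ} → Sub k ℓ → Chain k ℓ
e S T = S == T

De : ∀ {k ℓ} → Sub k ℓ → Chain k ℓ
De {k} {ℓ} S T = Σ₂ (allBoxes k ℓ) (λ x → x ∈ᵇ S ∧ e (S ∖ x) T)

D : ∀ {k ℓ} → Chain k ℓ → Chain k ℓ
D {k} {ℓ} v T = Σ₂ (allSubs k ℓ) (λ S → v S ∧ De S T)

IsPartition : (k ℓ : ℕ) → Vec ℕ k → Set
IsPartition k ℓ λ' = (∀ i → lookup λ' i ≤ ℓ) × (∀ i j → i F.≤ j → lookup λ' j ≤ lookup λ' i)

-- mult_λ(s): number of parts of λ equal to s (zeros counted)
mult : ∀ {k} → Vec ℕ k → ℕ → ℕ
mult λ' s = countᵇ (λ p → p ≡ᵇ s) λ'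

rowSizes : ∀ {k ℓ} → Sub k ℓ → Vec ℕ k
rowSizes S = V.map ∣_∣ S

-- S ∈ Ω_λ : the multiset of row-intersection sizes of S is {λ₁,…,λ_k}
-- (all sizes lie in 0..ℓ, so comparing multiplicities of s = 0..ℓ suffices)
inOrbit : ∀ {k ℓ} → Vec ℕ k → Sub k ℓ → Bool
inOrbit {k} {ℓ} λ' S = foldr (λ s acc → (mult (rowSizes S) s ≡ᵇ mult λ' s) ∧ acc) true (upTo (suc ℓ))

-- e_λ = Σ_{S ∈ Ω_λ} e_S
eOrb : ∀ {k ℓ} → Vec ℕ k → Chain k ℓ
eOrb λ' = inOrbit λ'

module Submission where

-- Transposing D, the coefficient of e_T in D(v) is the sum of v(T ∪ {x}) over the boxes x ∉ T.
-- For T ∈ Ω_μ, adding a box to a row with t boxes replaces a part t of μ by t + 1, and the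
-- result lies in Ω_λ exactly when t = μᵢ = λᵢ − 1.  So D_{λ,μ} counts the ℓ − μᵢ free boxes
-- in each of the mult_μ(μᵢ) = mult_λ(λᵢ − 1) + 1 rows of T with μᵢ boxes.

open import Defs
open import Data.Nat using (ℕ; suc; _+_; _*_; _∸_)
open import Data.Fin using (Fin)
open import Data.Vec using (Vec; lookup)
open import Data.Bool using (true)
open import Relation.Binary.PropositionalEquality using (_≡_; _≢_)

open import Algebra.Bundles using (CommutativeRing)
import Algebra.Properties.CommutativeSemigroup as CommutativeSemigroupProperties
open import Data.Bool using (Bool; false; not; _∧_; _xor_; T)
open import Data.Bool.Properties as 𝔹
  using (∧-comm; ∧-assoc; ∧-zeroʳ; ∧-identityʳ; xor-assoc; xor-identityʳ; xor-same;
         not-distribˡ-xor; ∧-distribˡ-xor; T-≡; T-not-≡; ⇔→≡)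
open import Data.Fin as Fin using (zero; suc)
open import Data.Fin.Subset using (Subset; ∣_∣)
open import Data.List using (List; []; _∷_; _++_; foldr; map; concatMap; tabulate; allFin; upTo)
open import Data.List.Properties using (map-tabulate)
open import Data.List.Relation.Unary.All using (All; all?)
open import Data.List.Relation.Unary.All.Properties using (applyUpTo⁺₁; applyUpTo⁻)
open import Data.Nat using (zero; _≤_; _<_; _≡ᵇ_; _≟_; s≤s)
open import Data.Nat.Properties as ℕ
  using (≡ᵇ⇒≡; 1+n≢n; +-comm; +-assoc; +-suc; +-identityʳ; +-cancelˡ-≡; +-cancelʳ-≡;
         m+n∸n≡m; +-∸-assoc; ≤-pred; <⇒≤)
open import Data.Product using (_×_; _,_)
open import Data.Unit using (tt)
open import Data.Vec using ([]; _∷_; _[_]≔_; count; countᵇ)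
import Data.Vec as V
open import Data.Vec.Properties
  using (≡-dec; lookup∘update; lookup∘update′; []≔-idempotent; []≔-lookup; lookup-map; map-[]≔;
         tabulate∘lookup; tabulate-cong)
open import Function using (_∘_; _⇔_; mk⇔; Equivalence)
open import Function.Properties.Equivalence using () renaming (trans to ⇔-trans; sym to ⇔-sym)
open import Relation.Binary.Definitions using (DecidableEquality)
open import Relation.Binary.PropositionalEquality
  using (refl; sym; trans; cong; cong₂; subst; module ≡-Reasoning)
open import Relation.Nullary using (Dec; yes; no; does)
open import Relation.Nullary.Decidable using (⌊_⌋; isYes≗does; does-⇔; dec-true; dec-false)
open import Relation.Nullary.Decidable.Core using (T?; _×-dec_)
open import Relation.Unary using (Decidable)

open ≡-Reasoning

private
  module xor = CommutativeSemigroupProperties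
    (CommutativeRing.+-commutativeSemigroup 𝔹.xor-∧-commutativeRing)
  module + = CommutativeSemigroupProperties ℕ.+-commutativeSemigroup

𝟙 : Bool → ℕ
𝟙 true  = 1
𝟙 false = 0

toF₂-+ : ∀ m n → toF₂ (m + n) ≡ toF₂ m xor toF₂ n
toF₂-+ zero    n = refl
toF₂-+ (suc m) n = trans (cong not (toF₂-+ m n)) (not-distribˡ-xor (toF₂ m) (toF₂ n))

toF₂-* : ∀ m n → toF₂ (m * n) ≡ toF₂ m ∧ toF₂ n
toF₂-* zero    n = refl
toF₂-* (suc m) n = begin
  toF₂ (n + m * n)              ≡⟨ toF₂-+ n (m * n) ⟩
  toF₂ n xor toF₂ (m * n)       ≡⟨ cong (toF₂ n xor_) (toF₂-* m n) ⟩
  toF₂ n xor (toF₂ m ∧ toF₂ n)  ≡⟨ absorb (toF₂ m) (toF₂ n) ⟩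
  not (toF₂ m) ∧ toF₂ n         ∎
  where
  absorb : ∀ a b → b xor (a ∧ b) ≡ not a ∧ b
  absorb true  b = xor-same b
  absorb false b = xor-identityʳ b

toF₂-𝟙 : ∀ b → toF₂ (𝟙 b) ≡ b
toF₂-𝟙 true  = refl
toF₂-𝟙 false = refl

module _ {A : Set} where

  Σ₂-cong : ∀ (xs : List A) {f g : A → F₂} → (∀ a → f a ≡ g a) → Σ₂ xs f ≡ Σ₂ xs g
  Σ₂-cong []       f≗g = refl
  Σ₂-cong (x ∷ xs) f≗g = cong₂ _xor_ (f≗g x) (Σ₂-cong xs f≗g)

  Σ₂-++ : ∀ (xs ys : List A) f → Σ₂ (xs ++ ys) f ≡ Σ₂ xs f xor Σ₂ ys f
  Σ₂-++ []       ys f = refl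
  Σ₂-++ (x ∷ xs) ys f = trans (cong (f x xor_) (Σ₂-++ xs ys f)) (sym (xor-assoc (f x) _ _))

  Σ₂-false : ∀ (xs : List A) → Σ₂ xs (λ _ → false) ≡ false
  Σ₂-false []       = refl
  Σ₂-false (x ∷ xs) = Σ₂-false xs

  Σ₂-xor : ∀ (xs : List A) f g → Σ₂ xs (λ a → f a xor g a) ≡ Σ₂ xs f xor Σ₂ xs g
  Σ₂-xor []       f g = refl
  Σ₂-xor (x ∷ xs) f g =
    trans (cong ((f x xor g x) xor_) (Σ₂-xor xs f g)) (xor.interchange (f x) (g x) _ _)

  Σ₂-∧ˡ : ∀ (xs : List A) b f → Σ₂ xs (λ a → b ∧ f a) ≡ b ∧ Σ₂ xs f
  Σ₂-∧ˡ []       b f = sym (∧-zeroʳ b)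
  Σ₂-∧ˡ (x ∷ xs) b f = trans (cong ((b ∧ f x) xor_) (Σ₂-∧ˡ xs b f)) (sym (∧-distribˡ-xor b (f x) _))

module _ {A B : Set} where

  Σ₂-map : ∀ (h : A → B) xs f → Σ₂ (map h xs) f ≡ Σ₂ xs (f ∘ h)
  Σ₂-map h []       f = refl
  Σ₂-map h (x ∷ xs) f = cong (f (h x) xor_) (Σ₂-map h xs f)

  Σ₂-concatMap : ∀ (g : A → List B) xs f → Σ₂ (concatMap g xs) f ≡ Σ₂ xs (λ a → Σ₂ (g a) f)
  Σ₂-concatMap g []       f = refl
  Σ₂-concatMap g (x ∷ xs) f =
    trans (Σ₂-++ (g x) (concatMap g xs) f) (cong (Σ₂ (g x) f xor_) (Σ₂-concatMap g xs f))

  Σ₂-comm : ∀ xs ys (f : A → B → F₂) →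
    Σ₂ xs (λ a → Σ₂ ys (f a)) ≡ Σ₂ ys (λ b → Σ₂ xs (λ a → f a b))
  Σ₂-comm []       ys f = sym (Σ₂-false ys)
  Σ₂-comm (x ∷ xs) ys f = trans (cong (Σ₂ ys (f x) xor_) (Σ₂-comm xs ys f))
    (sym (Σ₂-xor ys (f x) (λ b → Σ₂ xs (λ a → f a b))))

Σ₂-tabulate : ∀ {B : Set} {n} (h : Fin n → B) (f : B → F₂) →
  Σ₂ (tabulate h) f ≡ Σ₂ (allFin n) (f ∘ h)
Σ₂-tabulate {n = n} h f =
  trans (cong (λ xs → Σ₂ xs f) (sym (map-tabulate (λ i → i) h))) (Σ₂-map h (allFin n) f)

module _ {A : Set} {P : A → Set} (P? : Decidable P) where

  count-∷ : ∀ {n} x (xs : Vec A n) → count P? (x ∷ xs) ≡ 𝟙 (does (P? x)) + count P? xs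
  count-∷ x xs with does (P? x)
  ... | true  = refl
  ... | false = refl

  count-[]≔ : ∀ {n} (v : Vec A n) i x →
    count P? (v [ i ]≔ x) + 𝟙 (does (P? (lookup v i))) ≡ count P? v + 𝟙 (does (P? x))
  count-[]≔ (y ∷ ys) zero x = begin
    count P? (x ∷ ys) + 𝟙 (does (P? y))                  ≡⟨ cong (_+ _) (count-∷ x ys) ⟩
    𝟙 (does (P? x)) + count P? ys + 𝟙 (does (P? y))      ≡⟨ +.xy∙z≈zy∙x (𝟙 (does (P? x))) _ _ ⟩
    𝟙 (does (P? y)) + count P? ys + 𝟙 (does (P? x))      ≡⟨ cong (_+ _) (count-∷ y ys) ⟨
    count P? (y ∷ ys) + 𝟙 (does (P? x))                  ∎
  count-[]≔ (y ∷ ys) (suc i) x = begin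
    count P? (y ∷ (ys [ i ]≔ x)) + 𝟙 (does (P? (lookup ys i)))
      ≡⟨ cong (_+ _) (count-∷ y (ys [ i ]≔ x)) ⟩
    𝟙 (does (P? y)) + count P? (ys [ i ]≔ x) + 𝟙 (does (P? (lookup ys i)))
      ≡⟨ +-assoc (𝟙 (does (P? y))) _ _ ⟩
    𝟙 (does (P? y)) + (count P? (ys [ i ]≔ x) + 𝟙 (does (P? (lookup ys i))))
      ≡⟨ cong (𝟙 (does (P? y)) +_) (count-[]≔ ys i x) ⟩
    𝟙 (does (P? y)) + (count P? ys + 𝟙 (does (P? x)))
      ≡⟨ +-assoc (𝟙 (does (P? y))) _ _ ⟨
    𝟙 (does (P? y)) + count P? ys + 𝟙 (does (P? x))
      ≡⟨ cong (_+ _) (count-∷ y ys) ⟨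
    count P? (y ∷ ys) + 𝟙 (does (P? x))
      ∎

Σ₂-lookup : ∀ {A : Set} {n} (P : A → Bool) (v : Vec A n) →
  Σ₂ (allFin n) (λ c → P (lookup v c)) ≡ toF₂ (countᵇ P v)
Σ₂-lookup P []       = refl
Σ₂-lookup {n = suc n} P (x ∷ xs) = begin
  P x xor Σ₂ (tabulate Fin.suc) (λ c → P (lookup (x ∷ xs) c))
    ≡⟨ cong (P x xor_) (trans (Σ₂-tabulate {n = n} Fin.suc (λ c → P (lookup (x ∷ xs) c)))
                              (Σ₂-lookup P xs)) ⟩
  P x xor toF₂ (countᵇ P xs)
    ≡⟨ cong (_xor _) (toF₂-𝟙 (P x)) ⟨
  toF₂ (𝟙 (P x)) xor toF₂ (countᵇ P xs)
    ≡⟨ toF₂-+ (𝟙 (P x)) (countᵇ P xs) ⟨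
  toF₂ (𝟙 (P x) + countᵇ P xs)
    ≡⟨ cong toF₂ (count-∷ (T? ∘ P) x xs) ⟨
  toF₂ (countᵇ P (x ∷ xs))
    ∎

Sifting : {A : Set} → DecidableEquality A → List A → Set
Sifting {A} _≟_ xs = ∀ u (h : A → F₂) → Σ₂ xs (λ a → does (a ≟ u) ∧ h a) ≡ h u

sifting-Bool : Sifting 𝔹._≟_ (false ∷ true ∷ [])
sifting-Bool false h = xor-identityʳ (h false)
sifting-Bool true  h = xor-identityʳ (h true)

sifting-Vec-zero : {A : Set} (_≟_ : DecidableEquality A) → Sifting (≡-dec _≟_) ([] ∷ [])
sifting-Vec-zero _≟_ [] h = xor-identityʳ (h [])

sifting-∷ : {A : Set} {_≟_ : DecidableEquality A} {n : ℕ} {xs : List A} {ys : List (Vec A n)} →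
  Sifting _≟_ xs → Sifting (≡-dec _≟_) ys →
  Sifting (≡-dec _≟_) (concatMap (λ v → map (_∷ v) xs) ys)
sifting-∷ {A} {_≟_} {n} {xs} {ys} sift-xs sift-ys (u ∷ us) h = begin
  Σ₂ (concatMap (λ v → map (_∷ v) xs) ys) δh
    ≡⟨ Σ₂-concatMap (λ v → map (_∷ v) xs) ys δh ⟩
  Σ₂ ys (λ v → Σ₂ (map (_∷ v) xs) δh)
    ≡⟨ Σ₂-cong ys (λ v → Σ₂-map (_∷ v) xs δh) ⟩
  Σ₂ ys (λ v → Σ₂ xs (λ a → (does (a ≟ u) ∧ does (≡-dec _≟_ v us)) ∧ h (a ∷ v)))
    ≡⟨ Σ₂-cong ys (λ v → Σ₂-cong xs (λ a → ∧-assoc (does (a ≟ u)) _ _)) ⟩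
  Σ₂ ys (λ v → Σ₂ xs (λ a → does (a ≟ u) ∧ (does (≡-dec _≟_ v us) ∧ h (a ∷ v))))
    ≡⟨ Σ₂-cong ys (λ v → sift-xs u (λ a → does (≡-dec _≟_ v us) ∧ h (a ∷ v))) ⟩
  Σ₂ ys (λ v → does (≡-dec _≟_ v us) ∧ h (u ∷ v))
    ≡⟨ sift-ys us (λ v → h (u ∷ v)) ⟩
  h (u ∷ us)
    ∎
  where
  δh : Vec A (suc n) → F₂
  δh w = does (≡-dec _≟_ w (u ∷ us)) ∧ h w

sifting-allSubsets : ∀ n → Sifting (≡-dec 𝔹._≟_) (allSubsets n)
sifting-allSubsets zero    = sifting-Vec-zero 𝔹._≟_
sifting-allSubsets (suc n) =
  sifting-∷ {xs = false ∷ true ∷ []} {ys = allSubsets n} sifting-Bool (sifting-allSubsets n)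

sifting-allSubs : ∀ k ℓ → Sifting (≡-dec (≡-dec 𝔹._≟_)) (allSubs k ℓ)
sifting-allSubs zero    ℓ = sifting-Vec-zero (≡-dec 𝔹._≟_)
sifting-allSubs (suc k) ℓ =
  sifting-∷ {xs = allSubsets ℓ} {ys = allSubs k ℓ} (sifting-allSubsets ℓ) (sifting-allSubs k ℓ)

module _ {k ℓ : ℕ} where

  setBox : Sub k ℓ → Box k ℓ → Bool → Sub k ℓ
  setBox S (r , c) b = S [ r ]≔ (lookup S r [ c ]≔ b)

  _⊕_ : Sub k ℓ → Box k ℓ → Sub k ℓ
  S ⊕ x = setBox S x true

  ∖-setBox : ∀ S x → S ∖ x ≡ setBox S x false
  ∖-setBox S (r , c) = refl

  ∈ᵇ-setBox : ∀ S x b → x ∈ᵇ setBox S x b ≡ b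
  ∈ᵇ-setBox S (r , c) b =
    trans (cong (λ row → lookup row c) (lookup∘update r S _)) (lookup∘update c (lookup S r) b)

  setBox-∈ᵇ : ∀ S x → setBox S x (x ∈ᵇ S) ≡ S
  setBox-∈ᵇ S (r , c) = trans (cong (S [ r ]≔_) ([]≔-lookup (lookup S r) c)) ([]≔-lookup S r)

  setBox-setBox : ∀ S x b b′ → setBox (setBox S x b) x b′ ≡ setBox S x b′
  setBox-setBox S (r , c) b b′ = begin
    (S [ r ]≔ row) [ r ]≔ (lookup (S [ r ]≔ row) r [ c ]≔ b′)
      ≡⟨ cong (λ row′ → (S [ r ]≔ row) [ r ]≔ (row′ [ c ]≔ b′)) (lookup∘update r S row) ⟩
    (S [ r ]≔ row) [ r ]≔ (row [ c ]≔ b′)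
      ≡⟨ []≔-idempotent S r ⟩
    S [ r ]≔ (row [ c ]≔ b′)
      ≡⟨ cong (S [ r ]≔_) ([]≔-idempotent (lookup S r) c) ⟩
    S [ r ]≔ (lookup S r [ c ]≔ b′)
      ∎
    where
    row : Subset ℓ
    row = lookup S r [ c ]≔ b

  _≟ˢ_ : DecidableEquality (Sub k ℓ)
  _≟ˢ_ = ≡-dec (≡-dec 𝔹._≟_)

  ∖-adjoint : ∀ S U x → (x ∈ᵇ S ∧ ((S ∖ x) == U)) ≡ ((S == (U ⊕ x)) ∧ not (x ∈ᵇ U))
  ∖-adjoint S U x = begin
    x ∈ᵇ S ∧ ⌊ (S ∖ x) ≟ˢ U ⌋        ≡⟨ cong (x ∈ᵇ S ∧_) (isYes≗does ((S ∖ x) ≟ˢ U)) ⟩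
    does removed?                   ≡⟨ does-⇔ (mk⇔ removed⇒added added⇒removed) removed? added? ⟩
    does added?                     ≡⟨ cong (_∧ not (x ∈ᵇ U)) (isYes≗does (S ≟ˢ (U ⊕ x))) ⟨
    ⌊ S ≟ˢ (U ⊕ x) ⌋ ∧ not (x ∈ᵇ U)  ∎
    where
    removed? : Dec (T (x ∈ᵇ S) × S ∖ x ≡ U)
    removed? = T? (x ∈ᵇ S) ×-dec (S ∖ x) ≟ˢ U
    added? : Dec (S ≡ U ⊕ x × T (not (x ∈ᵇ U)))
    added? = S ≟ˢ (U ⊕ x) ×-dec T? (not (x ∈ᵇ U))
    removed⇒added : T (x ∈ᵇ S) × S ∖ x ≡ U → S ≡ U ⊕ x × T (not (x ∈ᵇ U))
    removed⇒added (x∈S , refl) =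
        (begin
          S                                  ≡⟨ setBox-∈ᵇ S x ⟨
          setBox S x (x ∈ᵇ S)                ≡⟨ cong (setBox S x) (Equivalence.to T-≡ x∈S) ⟩
          setBox S x true                    ≡⟨ setBox-setBox S x false true ⟨
          setBox (setBox S x false) x true   ≡⟨ cong (_⊕ x) (∖-setBox S x) ⟨
          (S ∖ x) ⊕ x                        ∎)
      , subst (T ∘ not) (sym (trans (cong (x ∈ᵇ_) (∖-setBox S x)) (∈ᵇ-setBox S x false))) tt
    added⇒removed : S ≡ U ⊕ x × T (not (x ∈ᵇ U)) → T (x ∈ᵇ S) × S ∖ x ≡ U
    added⇒removed (refl , x∉U) =
        subst T (sym (∈ᵇ-setBox U x true)) tt
      , (begin
          (U ⊕ x) ∖ x                        ≡⟨ ∖-setBox (U ⊕ x) x ⟩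
          setBox (setBox U x true) x false   ≡⟨ setBox-setBox U x true false ⟩
          setBox U x false                   ≡⟨ cong (setBox U x) (Equivalence.to T-not-≡ x∉U) ⟨
          setBox U x (x ∈ᵇ U)                ≡⟨ setBox-∈ᵇ U x ⟩
          U                                  ∎)

D-coefficient : ∀ {k ℓ} (v : Chain k ℓ) (T : Sub k ℓ) →
  D v T ≡ Σ₂ (allBoxes k ℓ) (λ x → not (x ∈ᵇ T) ∧ v (T ⊕ x))
D-coefficient {k} {ℓ} v T = begin
  Σ₂ subs (λ S → v S ∧ Σ₂ boxes (λ x → x ∈ᵇ S ∧ e (S ∖ x) T))
    ≡⟨ Σ₂-cong subs (λ S → Σ₂-∧ˡ boxes (v S) _) ⟨
  Σ₂ subs (λ S → Σ₂ boxes (λ x → v S ∧ (x ∈ᵇ S ∧ e (S ∖ x) T)))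
    ≡⟨ Σ₂-comm subs boxes (λ S x → v S ∧ (x ∈ᵇ S ∧ e (S ∖ x) T)) ⟩
  Σ₂ boxes (λ x → Σ₂ subs (λ S → v S ∧ (x ∈ᵇ S ∧ e (S ∖ x) T)))
    ≡⟨ Σ₂-cong boxes (λ x → Σ₂-cong subs (λ S → cong (v S ∧_) (∖-adjoint S T x))) ⟩
  Σ₂ boxes (λ x → Σ₂ subs (λ S → v S ∧ ((S == (T ⊕ x)) ∧ not (x ∈ᵇ T))))
    ≡⟨ Σ₂-cong boxes (λ x → Σ₂-cong subs (λ S → rotate (v S) (not (x ∈ᵇ T)))) ⟩
  Σ₂ boxes (λ x → Σ₂ subs (λ S → does (S ≟ˢ (T ⊕ x)) ∧ (not (x ∈ᵇ T) ∧ v S)))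
    ≡⟨ Σ₂-cong boxes (λ x → sifting-allSubs k ℓ (T ⊕ x) (λ S → not (x ∈ᵇ T) ∧ v S)) ⟩
  Σ₂ boxes (λ x → not (x ∈ᵇ T) ∧ v (T ⊕ x))
    ∎
  where
  subs : List (Sub k ℓ)
  subs = allSubs k ℓ
  boxes : List (Box k ℓ)
  boxes = allBoxes k ℓ
  rotate : ∀ a {S U} b → a ∧ (⌊ S ≟ˢ U ⌋ ∧ b) ≡ does (S ≟ˢ U) ∧ (b ∧ a)
  rotate a {S} {U} b =
    trans (∧-comm a _) (trans (∧-assoc _ b a) (cong (_∧ (b ∧ a)) (isYes≗does (S ≟ˢ U))))

does≡true⇔ : ∀ {P : Set} (P? : Dec P) → does P? ≡ true ⇔ P
does≡true⇔ P? = mk⇔ (witness P?) (dec-true P?)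
  where
  witness : ∀ {P : Set} (P? : Dec P) → does P? ≡ true → P
  witness (yes p) _ = p

does-all? : ∀ {A : Set} {P : A → Set} (P? : Decidable P) xs →
  does (all? P? xs) ≡ foldr (λ a acc → does (P? a) ∧ acc) true xs
does-all? P? []       = refl
does-all? P? (x ∷ xs) = cong (does (P? x) ∧_) (does-all? P? xs)

All-upTo⇔ : ∀ {P : ℕ → Set} n → All P (upTo (suc n)) ⇔ (∀ s → s ≤ n → P s)
All-upTo⇔ n = mk⇔ (λ all s s≤n → applyUpTo⁻ (λ s → s) (suc n) all (s≤s s≤n))
                  (λ all → applyUpTo⁺₁ (λ s → s) (suc n) (λ {s} s<1+n → all s (≤-pred s<1+n)))

[]≔-agree : ∀ {A : Set} {n} (u v : Vec A n) i →
  (∀ j → j ≢ i → lookup u j ≡ lookup v j) → u [ i ]≔ lookup v i ≡ v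
[]≔-agree u v i agree = begin
  u [ i ]≔ lookup v i                       ≡⟨ tabulate∘lookup _ ⟨
  V.tabulate (lookup (u [ i ]≔ lookup v i)) ≡⟨ tabulate-cong pointwise ⟩
  V.tabulate (lookup v)                     ≡⟨ tabulate∘lookup v ⟩
  v                                         ∎
  where
  pointwise : ∀ j → lookup (u [ i ]≔ lookup v i) j ≡ lookup v j
  pointwise j with j Fin.≟ i
  ... | yes refl = lookup∘update i u (lookup v i)
  ... | no j≢i   = trans (lookup∘update′ j≢i u (lookup v i)) (agree j j≢i)

∣[]≔true∣ : ∀ {n} (v : Subset n) c → lookup v c ≡ false → ∣ v [ c ]≔ true ∣ ≡ suc ∣ v ∣
∣[]≔true∣ v c c∉v = begin
  ∣ v [ c ]≔ true ∣
    ≡⟨ +-identityʳ _ ⟨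
  ∣ v [ c ]≔ true ∣ + 𝟙 (does (false 𝔹.≟ true))
    ≡⟨ cong (λ b → ∣ v [ c ]≔ true ∣ + 𝟙 (does (b 𝔹.≟ true))) c∉v ⟨
  ∣ v [ c ]≔ true ∣ + 𝟙 (does (lookup v c 𝔹.≟ true))
    ≡⟨ count-[]≔ (𝔹._≟ true) v c true ⟩
  ∣ v ∣ + 1
    ≡⟨ +-comm ∣ v ∣ 1 ⟩
  suc ∣ v ∣
    ∎

countᵇ-not : ∀ {n} (v : Subset n) → countᵇ not v ≡ n ∸ ∣ v ∣
countᵇ-not v = trans (sym (m+n∸n≡m (countᵇ not v) ∣ v ∣)) (cong (_∸ ∣ v ∣) (partition v))
  where
  partition : ∀ {n} (v : Subset n) → countᵇ not v + ∣ v ∣ ≡ n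
  partition []          = refl
  partition (true ∷ v)  = trans (+-suc (countᵇ not v) ∣ v ∣) (cong suc (partition v))
  partition (false ∷ v) = cong suc (partition v)

SameMults : ∀ {k} → ℕ → Vec ℕ k → Vec ℕ k → Set
SameMults ℓ u v = ∀ s → s ≤ ℓ → mult u s ≡ mult v s

inOrbit⇔SameMults : ∀ {k ℓ} (ν : Vec ℕ k) (S : Sub k ℓ) →
  inOrbit ν S ≡ true ⇔ SameMults ℓ (rowSizes S) ν
inOrbit⇔SameMults {ℓ = ℓ} ν S =
  subst (λ b → b ≡ true ⇔ SameMults ℓ (rowSizes S) ν) (does-all? sameMult? (upTo (suc ℓ)))
    (⇔-trans (does≡true⇔ (all? sameMult? (upTo (suc ℓ)))) (All-upTo⇔ ℓ))
  where
  sameMult? : ∀ s → Dec (mult (rowSizes S) s ≡ mult ν s)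
  sameMult? s = mult (rowSizes S) s ≟ mult ν s

raise : ∀ {k} → Vec ℕ k → Fin k → Vec ℕ k
raise v i = v [ i ]≔ suc (lookup v i)

mult-raise : ∀ {k} (v : Vec ℕ k) i s →
  mult (raise v i) s + 𝟙 (lookup v i ≡ᵇ s) ≡ mult v s + 𝟙 (suc (lookup v i) ≡ᵇ s)
mult-raise v i s = count-[]≔ (T? ∘ (_≡ᵇ s)) v i (suc (lookup v i))

mult-raise-self : ∀ {k} (v : Vec ℕ k) i → mult (raise v i) (lookup v i) + 1 ≡ mult v (lookup v i)
mult-raise-self v i = begin
  mult (raise v i) a + 1           ≡⟨ cong (λ b → mult (raise v i) a + 𝟙 b) (dec-true (a ≟ a) refl) ⟨
  mult (raise v i) a + 𝟙 (a ≡ᵇ a)  ≡⟨ mult-raise v i a ⟩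
  mult v a + 𝟙 (suc a ≡ᵇ a)        ≡⟨ cong (λ b → mult v a + 𝟙 b) (dec-false (suc a ≟ a) 1+n≢n) ⟩
  mult v a + 0                     ≡⟨ +-identityʳ (mult v a) ⟩
  mult v a                         ∎
  where
  a : ℕ
  a = lookup v i

-- For t ≠ a, raising t in u leaves one more part equal to a than raising a in v does.
raise-sameMults⇔ : ∀ {k ℓ} (u v : Vec ℕ k) r i → SameMults ℓ u v → lookup v i ≤ ℓ →
  SameMults ℓ (raise u r) (raise v i) ⇔ lookup u r ≡ lookup v i
raise-sameMults⇔ {ℓ = ℓ} u v r i same a≤ℓ = mk⇔ parts-equal raised-same
  where
  t a : ℕ
  t = lookup u r
  a = lookup v i

  parts-equal : SameMults ℓ (raise u r) (raise v i) → t ≡ a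
  parts-equal same′ = ≡ᵇ⇒≡ t a (𝟙≡suc⇒T (+-cancelˡ-≡ Y _ _ (begin
    Y + 𝟙 (t ≡ᵇ a)                          ≡⟨ mult-raise u r a ⟩
    mult u a + 𝟙 (suc t ≡ᵇ a)               ≡⟨ cong (_+ 𝟙 (suc t ≡ᵇ a)) (same a a≤ℓ) ⟩
    mult v a + 𝟙 (suc t ≡ᵇ a)               ≡⟨ cong (_+ 𝟙 (suc t ≡ᵇ a)) (mult-raise-self v i) ⟨
    mult (raise v i) a + 1 + 𝟙 (suc t ≡ᵇ a) ≡⟨ cong (λ m → m + 1 + 𝟙 (suc t ≡ᵇ a)) (same′ a a≤ℓ) ⟨
    Y + 1 + 𝟙 (suc t ≡ᵇ a)                  ≡⟨ +-assoc Y 1 _ ⟩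
    Y + suc (𝟙 (suc t ≡ᵇ a))                ∎)))
    where
    Y : ℕ
    Y = mult (raise u r) a
    𝟙≡suc⇒T : ∀ {b n} → 𝟙 b ≡ suc n → T b
    𝟙≡suc⇒T {true} _ = tt

  raised-same : t ≡ a → SameMults ℓ (raise u r) (raise v i)
  raised-same t≡a s s≤ℓ = +-cancelʳ-≡ (𝟙 (a ≡ᵇ s)) _ _ (begin
    mult (raise u r) s + 𝟙 (a ≡ᵇ s)  ≡⟨ cong (λ t′ → mult (raise u r) s + 𝟙 (t′ ≡ᵇ s)) t≡a ⟨
    mult (raise u r) s + 𝟙 (t ≡ᵇ s)  ≡⟨ mult-raise u r s ⟩
    mult u s + 𝟙 (suc t ≡ᵇ s)        ≡⟨ cong₂ (λ m t′ → m + 𝟙 (suc t′ ≡ᵇ s)) (same s s≤ℓ) t≡a ⟩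
    mult v s + 𝟙 (suc a ≡ᵇ s)        ≡⟨ mult-raise v i s ⟨
    mult (raise v i) s + 𝟙 (a ≡ᵇ s)  ∎)

rowSizes-⊕ : ∀ {k ℓ} (T : Sub k ℓ) r c → lookup (lookup T r) c ≡ false →
  rowSizes (T ⊕ (r , c)) ≡ raise (rowSizes T) r
rowSizes-⊕ T r c c∉Tᵣ = begin
  V.map ∣_∣ (T [ r ]≔ (lookup T r [ c ]≔ true))     ≡⟨ map-[]≔ ∣_∣ T r ⟩
  rowSizes T [ r ]≔ ∣ lookup T r [ c ]≔ true ∣      ≡⟨ cong (rowSizes T [ r ]≔_) size ⟩
  rowSizes T [ r ]≔ suc (lookup (rowSizes T) r)    ∎
  where
  size : ∣ lookup T r [ c ]≔ true ∣ ≡ suc (lookup (rowSizes T) r)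
  size = trans (∣[]≔true∣ (lookup T r) c c∉Tᵣ) (cong suc (sym (lookup-map r ∣_∣ T)))

inOrbit-raise-⊕ : ∀ {k ℓ} (μ : Vec ℕ k) i → lookup μ i ≤ ℓ → (T : Sub k ℓ) →
  SameMults ℓ (rowSizes T) μ → ∀ r c → lookup (lookup T r) c ≡ false →
  inOrbit (raise μ i) (T ⊕ (r , c)) ≡ (lookup (rowSizes T) r ≡ᵇ lookup μ i)
inOrbit-raise-⊕ {ℓ = ℓ} μ i a≤ℓ T T-mults r c c∉Tᵣ = ⇔→≡ {z = true}
  (⇔-trans (inOrbit⇔SameMults (raise μ i) (T ⊕ (r , c)))
    (subst (λ w → SameMults ℓ w (raise μ i) ⇔ _) (sym (rowSizes-⊕ T r c c∉Tᵣ))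
      (⇔-trans (raise-sameMults⇔ (rowSizes T) μ r i T-mults a≤ℓ)
        (⇔-sym (does≡true⇔ (lookup (rowSizes T) r ≟ lookup μ i))))))

≡ᵇ-∧-subst : ∀ (g : ℕ → Bool) m n → (m ≡ᵇ n) ∧ g m ≡ (m ≡ᵇ n) ∧ g n
≡ᵇ-∧-subst g m n with m ≡ᵇ n in m≡ᵇn
... | false = refl
... | true  = cong g (≡ᵇ⇒≡ m n (subst T (sym m≡ᵇn) tt))

row-contribution : ∀ {k ℓ} (μ : Vec ℕ k) i → lookup μ i ≤ ℓ → (T : Sub k ℓ) →
  SameMults ℓ (rowSizes T) μ → ∀ r →
  Σ₂ (allFin ℓ) (λ c → not ((r , c) ∈ᵇ T) ∧ inOrbit (raise μ i) (T ⊕ (r , c)))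
    ≡ toF₂ (ℓ ∸ lookup μ i) ∧ (lookup (rowSizes T) r ≡ᵇ lookup μ i)
row-contribution {ℓ = ℓ} μ i a≤ℓ T T-mults r = begin
  Σ₂ (allFin ℓ) (λ c → not (lookup Tᵣ c) ∧ inOrbit (raise μ i) (T ⊕ (r , c)))
    ≡⟨ Σ₂-cong (allFin ℓ) box-term ⟩
  Σ₂ (allFin ℓ) (λ c → t≡ᵇa ∧ not (lookup Tᵣ c))
    ≡⟨ Σ₂-∧ˡ (allFin ℓ) t≡ᵇa (λ c → not (lookup Tᵣ c)) ⟩
  t≡ᵇa ∧ Σ₂ (allFin ℓ) (λ c → not (lookup Tᵣ c))
    ≡⟨ cong (t≡ᵇa ∧_) (Σ₂-lookup not Tᵣ) ⟩
  t≡ᵇa ∧ toF₂ (countᵇ not Tᵣ)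
    ≡⟨ cong (λ m → t≡ᵇa ∧ toF₂ m) free ⟩
  t≡ᵇa ∧ toF₂ (ℓ ∸ t)
    ≡⟨ ≡ᵇ-∧-subst (λ m → toF₂ (ℓ ∸ m)) t a ⟩
  t≡ᵇa ∧ toF₂ (ℓ ∸ a)
    ≡⟨ ∧-comm t≡ᵇa _ ⟩
  toF₂ (ℓ ∸ a) ∧ t≡ᵇa
    ∎
  where
  a t : ℕ
  a = lookup μ i
  t = lookup (rowSizes T) r
  Tᵣ : Subset ℓ
  Tᵣ = lookup T r
  t≡ᵇa : Bool
  t≡ᵇa = t ≡ᵇ a

  free : countᵇ not Tᵣ ≡ ℓ ∸ t
  free = trans (countᵇ-not Tᵣ) (cong (ℓ ∸_) (sym (lookup-map r ∣_∣ T)))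

  box-term : ∀ c → not (lookup Tᵣ c) ∧ inOrbit (raise μ i) (T ⊕ (r , c)) ≡ t≡ᵇa ∧ not (lookup Tᵣ c)
  box-term c with lookup Tᵣ c in c∈?Tᵣ
  ... | true  = sym (∧-zeroʳ t≡ᵇa)
  ... | false = trans (inOrbit-raise-⊕ μ i a≤ℓ T T-mults r c c∈?Tᵣ) (sym (∧-identityʳ t≡ᵇa))

D-eOrb-raise : ∀ {k ℓ} (μ : Vec ℕ k) i → lookup μ i ≤ ℓ → (T : Sub k ℓ) → inOrbit μ T ≡ true →
  D (eOrb (raise μ i)) T ≡ toF₂ ((ℓ ∸ lookup μ i) * mult μ (lookup μ i))
D-eOrb-raise {k} {ℓ} μ i a≤ℓ T T∈Ωμ = begin
  D (eOrb (raise μ i)) T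
    ≡⟨ D-coefficient (eOrb (raise μ i)) T ⟩
  Σ₂ (allBoxes k ℓ) summand
    ≡⟨ Σ₂-concatMap (λ r → map (r ,_) (allFin ℓ)) (allFin k) summand ⟩
  Σ₂ (allFin k) (λ r → Σ₂ (map (r ,_) (allFin ℓ)) summand)
    ≡⟨ Σ₂-cong (allFin k) (λ r → trans (Σ₂-map (r ,_) (allFin ℓ) summand)
                                        (row-contribution μ i a≤ℓ T T-mults r)) ⟩
  Σ₂ (allFin k) (λ r → toF₂ (ℓ ∸ a) ∧ (lookup (rowSizes T) r ≡ᵇ a))
    ≡⟨ Σ₂-∧ˡ (allFin k) (toF₂ (ℓ ∸ a)) (λ r → lookup (rowSizes T) r ≡ᵇ a) ⟩
  toF₂ (ℓ ∸ a) ∧ Σ₂ (allFin k) (λ r → lookup (rowSizes T) r ≡ᵇ a)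
    ≡⟨ cong (toF₂ (ℓ ∸ a) ∧_) (Σ₂-lookup (_≡ᵇ a) (rowSizes T)) ⟩
  toF₂ (ℓ ∸ a) ∧ toF₂ (mult (rowSizes T) a)
    ≡⟨ cong (λ m → toF₂ (ℓ ∸ a) ∧ toF₂ m) (T-mults a a≤ℓ) ⟩
  toF₂ (ℓ ∸ a) ∧ toF₂ (mult μ a)
    ≡⟨ toF₂-* (ℓ ∸ a) (mult μ a) ⟨
  toF₂ ((ℓ ∸ a) * mult μ a)
    ∎
  where
  a : ℕ
  a = lookup μ i

  T-mults : SameMults ℓ (rowSizes T) μ
  T-mults = Equivalence.to (inOrbit⇔SameMults μ T) T∈Ωμ

  summand : Box k ℓ → F₂
  summand x = not (x ∈ᵇ T) ∧ inOrbit (raise μ i) (T ⊕ x)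

proposition4p1 : (k ℓ : ℕ) (λ' μ : Vec ℕ k) → IsPartition k ℓ λ' → IsPartition k ℓ μ →
    (i : Fin k) → suc (lookup μ i) ≡ lookup λ' i → (∀ j → j ≢ i → lookup μ j ≡ lookup λ' j) →
    (T : Sub k ℓ) → inOrbit μ T ≡ true →
    D (eOrb λ') T ≡ toF₂ ((ℓ ∸ lookup λ' i + 1) * (mult λ' (lookup λ' i ∸ 1) + 1))
proposition4p1 k ℓ λ' μ (parts≤ℓ , _) _ i raised agree T T∈Ωμ = begin
  D (eOrb λ') T                  ≡⟨ cong (λ ν → D (eOrb ν) T) λ'-raises-μ ⟨
  D (eOrb (raise μ i)) T         ≡⟨ D-eOrb-raise μ i (<⇒≤ a<ℓ) T T∈Ωμ ⟩
  toF₂ ((ℓ ∸ a) * mult μ a)       ≡⟨ cong toF₂ (cong₂ _*_ free-boxes multiplicity) ⟩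
  toF₂ ((ℓ ∸ lookup λ' i + 1) * (mult λ' (lookup λ' i ∸ 1) + 1)) ∎
  where
  a : ℕ
  a = lookup μ i

  λ'-raises-μ : raise μ i ≡ λ'
  λ'-raises-μ = trans (cong (μ [ i ]≔_) raised) ([]≔-agree μ λ' i agree)

  a<ℓ : a < ℓ
  a<ℓ = subst (_≤ ℓ) (sym raised) (parts≤ℓ i)

  free-boxes : ℓ ∸ a ≡ ℓ ∸ lookup λ' i + 1
  free-boxes = begin
    ℓ ∸ a                  ≡⟨ +-∸-assoc 1 a<ℓ ⟩
    suc (ℓ ∸ suc a)        ≡⟨ +-comm 1 (ℓ ∸ suc a) ⟩
    ℓ ∸ suc a + 1          ≡⟨ cong (λ p → ℓ ∸ p + 1) raised ⟩
    ℓ ∸ lookup λ' i + 1    ∎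

  multiplicity : mult μ a ≡ mult λ' (lookup λ' i ∸ 1) + 1
  multiplicity = trans (sym (mult-raise-self μ i))
    (cong₂ (λ ν s → mult ν s + 1) λ'-raises-μ (cong (_∸ 1) raised))
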